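{- Let $G$ be a graph, $B\subseteq V(G)$, and $S$ a vertex cover of $G$ with $B\subseteq S$ and $|S|=\delta(G-B)+p$, where $p$ is an integer with $0<p<\delta(G-B)/8$. Then for any $X\subseteq V(G)\setminus S$ with $|X|\ge\delta(G-B)-3p$, at most $2p$ vertices of $S$ have fewer than $2p$ neighbours in $X$.
   Context: Graphs are finite, simple, undirected; $G-B$ is the subgraph induced by $V(G)\setminus B$; $\delta$ denotes minimum degree. A vertex cover is a vertex set meeting every edge. -}

module Defs where

open import Data.Nat using (ℕ)
open import Data.Bool using (Bool; true; false; T; _∧_)
open import Data.Fin using (Fin)
open import Data.Fin.Subset using (Subset; _∈_; _∉_; ∣_∣; inside; outside)
open import Data.Vec using (tabulate; lookup)
open import Data.Product using (_×_; ∃)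
open import Relation.Binary.PropositionalEquality using (_≡_)
open import Data.Nat using (_≥_)

record Graph (n : ℕ) : Set where
  field
    adj   : Fin n → Fin n → Bool
    sym   : ∀ u v → adj u v ≡ adj v u
    irrefl : ∀ v → adj v v ≡ false
open Graph public

N : ∀ {n} → Graph n → Fin n → Subset n
N G v = tabulate (adj G v)

degIn : ∀ {n} → Graph n → Fin n → Subset n → ℕ
degIn G v X = ∣ tabulate (λ u → lookup X u ∧ adj G v u) ∣

memb : ∀ {n} → Subset n → Fin n → Bool
memb X u = lookup X u

compl : ∀ {n} → Subset n → Subset n
compl B = tabulate (λ u → Data.Bool.not (lookup B u))
  where import Data.Bool

-- δ(G − B) = d : G − B is nonempty, every vertex of G − B has at least d
-- neighbours in V(G) ∖ B, and some vertex of G − B has exactly d.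
MinDegMinus : ∀ {n} → Graph n → Subset n → ℕ → Set
MinDegMinus G B d =
  (∀ v → v ∉ B → degIn G v (compl B) ≥ d) ×
  ∃ (λ v → v ∉ B × degIn G v (compl B) ≡ d)

VertexCover : ∀ {n} → Graph n → Subset n → Set
VertexCover G S = ∀ u v → T (adj G u v) → u ∈ S Data.Sum.⊎ v ∈ S
  where import Data.Sum

lowIn : ∀ {n} → Graph n → Subset n → Subset n → ℕ → Subset n
lowIn G S X k = tabulate (λ v → lookup S v ∧ (degIn G v X Data.Nat.<ᵇ k))
  where import Data.Nat

-- Let L be the set of vertices of S with fewer than 2p neighbours in X and
-- ℓ = |L|. A vertex x ∈ X lies outside the cover S, so all its neighbours lie
-- in S, and it has at least δ(G − B) = d of them; since |S| = d + p, x misses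
-- at most p vertices of S and hence is adjacent to at least ℓ − p vertices of L.
-- Counting the edges between L and X from both sides gives
-- |X| (ℓ − p) ≤ ℓ (2p − 1), which is impossible once ℓ > 2p and |X| > 5p.
module Submission where

open import Defs hiding (sym)
open import Data.Nat using (ℕ; _+_; _*_; _∸_; _≤_; _<_; _≥_)
open import Data.Fin.Subset using (Subset; _⊆_; _∈_; _∉_; ∣_∣)
open import Relation.Binary.PropositionalEquality using (_≡_)

open import Data.Nat using (zero; suc; z≤n; s≤s; _<ᵇ_)
open import Data.Nat.Properties
open import Data.Nat.Tactic.RingSolver using (solve-∀)
open import Data.Bool using (Bool; true; false; T; _∧_)
open import Data.Bool.Properties using (T-∧; ∧-commutativeMonoid)
open import Data.Fin using (Fin)
import Data.Fin as Fin
open import Data.Vec using ([]; _∷_; lookup; tabulate)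
open import Data.Vec.Properties using (lookup∘tabulate; lookup⇒[]=; []=⇒lookup)
open import Data.Product using (_,_; _×_; proj₁; proj₂)
open import Data.Sum using (inj₁; inj₂)
open import Data.Unit using (tt)
open import Data.Empty using (⊥-elim)
open import Algebra.Bundles using (CommutativeMonoid)
open import Function using (_∘_; Equivalence)
open import Relation.Binary.PropositionalEquality
  using (refl; sym; trans; cong; cong₂; subst; module ≡-Reasoning)
open import Algebra.Properties.Semiring.Sum +-*-semiring
  using (sum; sum-syntax; ∑-distrib-+; ∑-comm; sum-cong-≗; *-distribˡ-sum; *-distribʳ-sum)
open import Algebra.Properties.CommutativeSemigroup +-commutativeSemigroup
  using (xy∙z≈xz∙y; x∙yz≈xz∙y)
open import Algebra.Properties.CommutativeSemigroup
  (CommutativeMonoid.commutativeSemigroup ∧-commutativeMonoid)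
  using () renaming (x∙yz≈y∙xz to ∧-left-comm)

[_] : Bool → ℕ
[ true ]  = 1
[ false ] = 0

[∧] : ∀ a b → [ a ∧ b ] ≡ [ a ] * [ b ]
[∧] true  b = sym (+-identityʳ [ b ])
[∧] false b = refl

[]*-mono-≤ : ∀ b {m n} → (T b → m ≤ n) → [ b ] * m ≤ [ b ] * n
[]*-mono-≤ true  m≤n = *-monoʳ-≤ 1 (m≤n tt)
[]*-mono-≤ false m≤n = z≤n

sum-mono-≤ : ∀ {n} {f g : Fin n → ℕ} → (∀ i → f i ≤ g i) → sum f ≤ sum g
sum-mono-≤ {zero}  f≤g = z≤n
sum-mono-≤ {suc n} f≤g = +-mono-≤ (f≤g Fin.zero) (sum-mono-≤ (f≤g ∘ Fin.suc))

∣p∣≡∑ : ∀ {n} (A : Subset n) → ∣ A ∣ ≡ ∑[ v < n ] [ lookup A v ]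
∣p∣≡∑ []          = refl
∣p∣≡∑ (true  ∷ A) = cong suc (∣p∣≡∑ A)
∣p∣≡∑ (false ∷ A) = ∣p∣≡∑ A

sumIn : ∀ {n} → Subset n → (Fin n → ℕ) → ℕ
sumIn {n} A f = ∑[ v < n ] ([ lookup A v ] * f v)

syntax sumIn A (λ v → x) = ∑[ v ∈ A ] x

module _ {n : ℕ} where

  ∈⇒T : ∀ {A : Subset n} {v} → v ∈ A → T (lookup A v)
  ∈⇒T {A} {v} v∈A = subst T (sym ([]=⇒lookup v∈A)) tt

  T⇒∈ : ∀ {A : Subset n} {v} → T (lookup A v) → v ∈ A
  T⇒∈ {A} {v} t with lookup A v in eq
  ... | true = lookup⇒[]= v A eq

  ∣tabulate∣≡∑ : (f : Fin n → Bool) → ∣ tabulate f ∣ ≡ ∑[ v < n ] [ f v ]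
  ∣tabulate∣≡∑ f = trans (∣p∣≡∑ (tabulate f)) (sum-cong-≗ (cong [_] ∘ lookup∘tabulate f))

  sumIn-const : ∀ (A : Subset n) c → ∑[ v ∈ A ] c ≡ ∣ A ∣ * c
  sumIn-const A c = trans (sym (*-distribʳ-sum c (λ v → [ lookup A v ]))) (cong (_* c) (sym (∣p∣≡∑ A)))

  sumIn-+ : ∀ (A : Subset n) f g → ∑[ v ∈ A ] (f v + g v) ≡ sumIn A f + sumIn A g
  sumIn-+ A f g = trans (sum-cong-≗ (λ v → *-distribˡ-+ [ lookup A v ] (f v) (g v)))
                        (∑-distrib-+ (λ v → [ lookup A v ] * f v) (λ v → [ lookup A v ] * g v))

  sumIn-mono-≤ : ∀ (A : Subset n) {f g} → (∀ {v} → v ∈ A → f v ≤ g v) → sumIn A f ≤ sumIn A g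
  sumIn-mono-≤ A f≤g = sum-mono-≤ (λ v → []*-mono-≤ (lookup A v) (f≤g ∘ T⇒∈))

edges : ∀ {n} → Graph n → Subset n → Subset n → ℕ
edges G A Y = ∑[ v ∈ A ] degIn G v Y

module _ {n : ℕ} (G : Graph n) where

  degIn≡∑ : ∀ v Y → degIn G v Y ≡ ∑[ u < n ] [ lookup Y u ∧ adj G v u ]
  degIn≡∑ v Y = ∣tabulate∣≡∑ (λ u → lookup Y u ∧ adj G v u)

  degIn-monoʳ : ∀ {v Y Z} → (∀ {u} → T (adj G v u) → T (lookup Y u) → T (lookup Z u)) →
                degIn G v Y ≤ degIn G v Z
  degIn-monoʳ {v} {Y} {Z} Y⇒Z = begin
    degIn G v Y                            ≡⟨ degIn≡∑ v Y ⟩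
    ∑[ u < n ] [ lookup Y u ∧ adj G v u ]  ≤⟨ sum-mono-≤ (λ u → pointwise (lookup Y u) (lookup Z u) (adj G v u) Y⇒Z) ⟩
    ∑[ u < n ] [ lookup Z u ∧ adj G v u ]  ≡⟨ degIn≡∑ v Z ⟨
    degIn G v Z                            ∎
    where
    open ≤-Reasoning
    pointwise : ∀ y z a → (T a → T y → T z) → [ y ∧ a ] ≤ [ z ∧ a ]
    pointwise true  true  a     _   = ≤-refl
    pointwise true  false true  y⇒z = ⊥-elim (y⇒z tt tt)
    pointwise true  false false _   = z≤n
    pointwise false z     a     _   = z≤n

  -- |L| − deg_L x ≤ |S| − deg_S x: the vertices of L not adjacent to x are among those of S.
  nonNeighbours-mono : ∀ {L S : Subset n} x → L ⊆ S → ∣ L ∣ + degIn G x S ≤ degIn G x L + ∣ S ∣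
  nonNeighbours-mono {L} {S} x L⊆S = begin
    ∣ L ∣ + degIn G x S
      ≡⟨ cong₂ _+_ (∣p∣≡∑ L) (degIn≡∑ x S) ⟩
    ∑[ v < n ] [ lookup L v ] + ∑[ v < n ] [ lookup S v ∧ adj G x v ]
      ≡⟨ ∑-distrib-+ (λ v → [ lookup L v ]) (λ v → [ lookup S v ∧ adj G x v ]) ⟨
    ∑[ v < n ] ([ lookup L v ] + [ lookup S v ∧ adj G x v ])
      ≤⟨ sum-mono-≤ (λ v → pointwise (lookup L v) (lookup S v) (adj G x v) (∈⇒T ∘ L⊆S ∘ T⇒∈)) ⟩
    ∑[ v < n ] ([ lookup L v ∧ adj G x v ] + [ lookup S v ])
      ≡⟨ ∑-distrib-+ (λ v → [ lookup L v ∧ adj G x v ]) (λ v → [ lookup S v ]) ⟩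
    ∑[ v < n ] [ lookup L v ∧ adj G x v ] + ∑[ v < n ] [ lookup S v ]
      ≡⟨ cong₂ _+_ (degIn≡∑ x L) (∣p∣≡∑ S) ⟨
    degIn G x L + ∣ S ∣
      ∎
    where
    open ≤-Reasoning
    pointwise : ∀ l s a → (T l → T s) → [ l ] + [ s ∧ a ] ≤ [ l ∧ a ] + [ s ]
    pointwise true  true  true  _   = ≤-refl
    pointwise true  true  false _   = ≤-refl
    pointwise true  false a     l⇒s = ⊥-elim (l⇒s tt)
    pointwise false true  true  _   = ≤-refl
    pointwise false true  false _   = z≤n
    pointwise false false a     _   = z≤n

  edges≡∑∑ : ∀ A Y → edges G A Y ≡ ∑[ v < n ] ∑[ u < n ] [ lookup A v ∧ (lookup Y u ∧ adj G v u) ]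
  edges≡∑∑ A Y = sum-cong-≗ λ v → begin
    [ lookup A v ] * degIn G v Y
      ≡⟨ cong ([ lookup A v ] *_) (degIn≡∑ v Y) ⟩
    [ lookup A v ] * ∑[ u < n ] [ lookup Y u ∧ adj G v u ]
      ≡⟨ *-distribˡ-sum [ lookup A v ] (λ u → [ lookup Y u ∧ adj G v u ]) ⟩
    ∑[ u < n ] ([ lookup A v ] * [ lookup Y u ∧ adj G v u ])
      ≡⟨ sum-cong-≗ (λ u → [∧] (lookup A v) (lookup Y u ∧ adj G v u)) ⟨
    ∑[ u < n ] [ lookup A v ∧ (lookup Y u ∧ adj G v u) ]
      ∎
    where open ≡-Reasoning

  edges-comm : ∀ A Y → edges G A Y ≡ edges G Y A
  edges-comm A Y = begin
    edges G A Y
      ≡⟨ edges≡∑∑ A Y ⟩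
    ∑[ v < n ] ∑[ u < n ] [ lookup A v ∧ (lookup Y u ∧ adj G v u) ]
      ≡⟨ ∑-comm (λ v u → [ lookup A v ∧ (lookup Y u ∧ adj G v u) ]) ⟩
    ∑[ u < n ] ∑[ v < n ] [ lookup A v ∧ (lookup Y u ∧ adj G v u) ]
      ≡⟨ sum-cong-≗ (λ u → sum-cong-≗ (λ v → cong [_] (swap u v))) ⟩
    ∑[ u < n ] ∑[ v < n ] [ lookup Y u ∧ (lookup A v ∧ adj G u v) ]
      ≡⟨ edges≡∑∑ Y A ⟨
    edges G Y A
      ∎
    where
    open ≡-Reasoning
    swap : ∀ u v → lookup A v ∧ (lookup Y u ∧ adj G v u) ≡ lookup Y u ∧ (lookup A v ∧ adj G u v)
    swap u v rewrite Graph.sym G v u = ∧-left-comm (lookup A v) (lookup Y u) (adj G u v)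

  edges-upperBound : ∀ A Y {k} → (∀ {v} → v ∈ A → degIn G v Y < k) → edges G A Y + ∣ A ∣ ≤ ∣ A ∣ * k
  edges-upperBound A Y {k} deg<k = begin
    edges G A Y + ∣ A ∣              ≡⟨ cong (edges G A Y +_) (sym (trans (sumIn-const A 1) (*-identityʳ ∣ A ∣))) ⟩
    edges G A Y + ∑[ v ∈ A ] 1       ≡⟨ sumIn-+ A (λ v → degIn G v Y) (λ _ → 1) ⟨
    ∑[ v ∈ A ] (degIn G v Y + 1)     ≤⟨ sumIn-mono-≤ A (λ v∈A → ≤-trans (≤-reflexive (+-comm _ 1)) (deg<k v∈A)) ⟩
    ∑[ v ∈ A ] k                     ≡⟨ sumIn-const A k ⟩
    ∣ A ∣ * k                        ∎
    where open ≤-Reasoning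

  edges-lowerBound : ∀ X A {c q} → (∀ {x} → x ∈ X → c ≤ degIn G x A + q) → ∣ X ∣ * c ≤ edges G X A + ∣ X ∣ * q
  edges-lowerBound X A {c} {q} c≤deg+q = begin
    ∣ X ∣ * c                        ≡⟨ sumIn-const X c ⟨
    ∑[ x ∈ X ] c                     ≤⟨ sumIn-mono-≤ X c≤deg+q ⟩
    ∑[ x ∈ X ] (degIn G x A + q)     ≡⟨ sumIn-+ X (λ x → degIn G x A) (λ _ → q) ⟩
    edges G X A + ∑[ x ∈ X ] q       ≡⟨ cong (edges G X A +_) (sumIn-const X q) ⟩
    edges G X A + ∣ X ∣ * q          ∎
    where open ≤-Reasoning

  cover-degIn : ∀ {S x} → VertexCover G S → x ∉ S → ∀ Y → degIn G x Y ≤ degIn G x S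
  cover-degIn {S} {x} cover x∉S Y = degIn-monoʳ {x} {Y} {S} neighbour∈S
    where
    neighbour∈S : ∀ {u} → T (adj G x u) → T (lookup Y u) → T (lookup S u)
    neighbour∈S {u} xu _ with cover x u xu
    ... | inj₁ x∈S = ⊥-elim (x∉S x∈S)
    ... | inj₂ u∈S = ∈⇒T u∈S

  ∈lowIn⇒ : ∀ {S X k v} → v ∈ lowIn G S X k → T (lookup S v) × T (degIn G v X <ᵇ k)
  ∈lowIn⇒ {S} {X} {k} {v} v∈L = Equivalence.to T-∧
    (subst T (lookup∘tabulate (λ u → lookup S u ∧ (degIn G u X <ᵇ k)) v) (∈⇒T v∈L))

  lowIn⊆ : ∀ S X k → lowIn G S X k ⊆ S
  lowIn⊆ S X k = T⇒∈ ∘ proj₁ ∘ ∈lowIn⇒ {S} {X} {k}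

  lowIn-degIn< : ∀ S X {k v} → v ∈ lowIn G S X k → degIn G v X < k
  lowIn-degIn< S X {k} {v} = <ᵇ⇒< (degIn G v X) k ∘ proj₂ ∘ ∈lowIn⇒ {S} {X} {k}

  outsideCover-∣L∣≤degIn+p : ∀ {B S L d p x} → MinDegMinus G B d → VertexCover G S → ∣ S ∣ ≡ d + p →
                             L ⊆ S → x ∉ B → x ∉ S → ∣ L ∣ ≤ degIn G x L + p
  outsideCover-∣L∣≤degIn+p {B} {S} {L} {d} {p} {x} δ cover ∣S∣≡d+p L⊆S x∉B x∉S =
    +-cancelʳ-≤ d ∣ L ∣ (degIn G x L + p) (begin
      ∣ L ∣ + d                ≤⟨ +-monoʳ-≤ ∣ L ∣ (≤-trans (proj₁ δ x x∉B) (cover-degIn cover x∉S (compl B))) ⟩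
      ∣ L ∣ + degIn G x S      ≤⟨ nonNeighbours-mono x L⊆S ⟩
      degIn G x L + ∣ S ∣      ≡⟨ cong (degIn G x L +_) ∣S∣≡d+p ⟩
      degIn G x L + (d + p)    ≡⟨ x∙yz≈xz∙y (degIn G x L) d p ⟩
      degIn G x L + p + d      ∎)
    where open ≤-Reasoning

crossing-surplus : ∀ p a b →
  (suc (5 * p) + b) * (suc (2 * p) + a) + (suc (2 * p) + a)
    ≡ suc (p * p + 6 * p + 1 + p * b + b + 3 * a * p + 2 * a + a * b)
      + ((suc (2 * p) + a) * (2 * p) + (suc (5 * p) + b) * p)
crossing-surplus = solve-∀

crossing-< : ∀ p {ℓ x} → 2 * p < ℓ → 5 * p < x → ℓ * (2 * p) + x * p < x * ℓ + ℓ
crossing-< p 2p<ℓ 5p<x with m≤n⇒∃[o]m+o≡n 2p<ℓ | m≤n⇒∃[o]m+o≡n 5p<x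
... | a , refl | b , refl =
  ≤-trans (s≤s (m≤n+m _ (p * p + 6 * p + 1 + p * b + b + 3 * a * p + 2 * a + a * b)))
          (≤-reflexive (sym (crossing-surplus p a b)))

lemma33 : ∀ {n} (G : Graph n) (B S : Subset n) (d p : ℕ) →
    MinDegMinus G B d → VertexCover G S → B ⊆ S → ∣ S ∣ ≡ d + p →
    0 < p → 8 * p < d →
    (X : Subset n) → (∀ {x} → x ∈ X → x ∉ S) → ∣ X ∣ + 3 * p ≥ d →
    ∣ lowIn G S X (2 * p) ∣ ≤ 2 * p
lemma33 G B S d p δ cover B⊆S ∣S∣≡d+p _ 8p<d X X⊆∁S ∣X∣+3p≥d =
  ≮⇒≥ λ 2p<ℓ → <⇒≱ (crossing-< p 2p<ℓ 5p<∣X∣) (begin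
    ∣ X ∣ * ℓ + ℓ                  ≤⟨ +-monoˡ-≤ ℓ (edges-lowerBound G X L ℓ≤degIn+p) ⟩
    edges G X L + ∣ X ∣ * p + ℓ    ≡⟨ xy∙z≈xz∙y (edges G X L) (∣ X ∣ * p) ℓ ⟩
    edges G X L + ℓ + ∣ X ∣ * p    ≡⟨ cong (λ e → e + ℓ + ∣ X ∣ * p) (edges-comm G X L) ⟩
    edges G L X + ℓ + ∣ X ∣ * p    ≤⟨ +-monoˡ-≤ (∣ X ∣ * p) (edges-upperBound G L X (lowIn-degIn< G S X)) ⟩
    ℓ * (2 * p) + ∣ X ∣ * p        ∎)
  where
  open ≤-Reasoning
  L = lowIn G S X (2 * p)
  ℓ = ∣ L ∣

  ℓ≤degIn+p : ∀ {x} → x ∈ X → ℓ ≤ degIn G x L + p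
  ℓ≤degIn+p x∈X = outsideCover-∣L∣≤degIn+p G δ cover ∣S∣≡d+p (lowIn⊆ G S X (2 * p)) (x∉S ∘ B⊆S) x∉S
    where x∉S = X⊆∁S x∈X

  5p<∣X∣ : 5 * p < ∣ X ∣
  5p<∣X∣ = +-cancelʳ-≤ (3 * p) _ _
    (subst (_≤ ∣ X ∣ + 3 * p) (cong suc (*-distribʳ-+ p 5 3)) (≤-trans 8p<d ∣X∣+3p≥d))
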